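{- Let $(\mathcal{L},\mathcal{G},\vartriangleleft)$ be a directed built lattice and let $G,G_1,G_2\in\mathcal{L}$ be such that $\mathrm{Fact}_{\mathcal{G}}(G_1)$ and $\mathrm{Fact}_{\mathcal{G}}(G_2)$ are both disjoint from $\mathrm{Fact}_{\mathcal{G}}(G)$, and such that $\mathrm{Fact}_{\mathcal{G}}(G_1)\cup\mathrm{Fact}_{\mathcal{G}}(G)$ and $\mathrm{Fact}_{\mathcal{G}}(G_2)\cup\mathrm{Fact}_{\mathcal{G}}(G)$ are both nested antichains. Then $$G_1\vartriangleleft^*G_2\iff G\vee G_1\vartriangleleft^*G\vee G_2.$$
   Context: Geometric lattice: finite lattice with bottom $\hat0$, top $\hat1$, all maximal chains between comparable elements of equal length, submodular rank, every element a join of atoms. A building set of $\mathcal{L}$ is $\mathcal{G}\subset\mathcal{L}\setminus\{\hat0\}$ such that for every $X$, with $\mathrm{Fact}_{\mathcal{G}}(X)$ the set of maximal elements of $\mathcal{G}\cap[\hat0,X]$, the join map $\prod_{G\in\mathrm{Fact}_{\mathcal{G}}(X)}[\hat0,G]\to[\hat0,X]$ is a poset isomorphism. A subset $\mathcal{S}\subset\mathcal{G}$ is nested if no antichain $\mathcal{A}\subset\mathcal{S}$ with $|\mathcal{A}|\ge2$ has $\bigvee\mathcal{A}\in\mathcal{G}$. A directed built lattice is a built lattice with a linear order $\vartriangleleft$ on the atoms of $\mathcal{L}$. For $X\in\mathcal{L}$, $w(X)$ is the word listing the atoms below $X$ in $\vartriangleleft$-increasing order; $X_1\vartriangleleft^*X_2$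 if $w(X_2)$ is an initial subword of $w(X_1)$ or $w(X_1)$ is lexicographically smaller than $w(X_2)$; this is a total order on $\mathcal{L}$. -}

module Defs where

open import Level using (0ℓ)
open import Data.Nat using (ℕ; zero; suc; _+_; _≤_)
open import Data.Product using (Σ; ∃; _×_; _,_)
open import Data.Sum using (_⊎_)
open import Data.Empty using (⊥)
open import Data.List using (List; []; _∷_; foldr; length; _++_)
open import Data.List.Membership.Propositional using (_∈_)
open import Data.List.Relation.Unary.All using (All)
open import Data.List.Relation.Unary.AllPairs using (AllPairs)
open import Data.List.Relation.Unary.Unique.Propositional using (Unique)
open import Data.List.Relation.Binary.Pointwise using (Pointwise)
open import Relation.Nullary using (¬_; Dec)
open import Relation.Binary.PropositionalEquality using (_≡_; _≢_)
open import Relation.Binary.Lattice.Structures using (IsBoundedLattice)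
open import Function.Bundles using (_⇔_)

module Order {C : Set} (_≼_ : C → C → Set) (bot : C) where

  _⋖_ : C → C → Set
  x ⋖ y = (x ≼ y) × (x ≢ y) × (∀ z → x ≼ z → z ≼ y → (z ≡ x) ⊎ (z ≡ y))

  IsAtom : C → Set
  IsAtom a = bot ⋖ a

  data MaxChain : C → C → ℕ → Set where
    done : ∀ {x} → MaxChain x x zero
    step : ∀ {x z y k} → x ⋖ z → MaxChain z y k → MaxChain x y (suc k)

  IsLub : (C → Set) → C → Set
  IsLub S x = (∀ s → S s → s ≼ x) × (∀ y → (∀ s → S s → s ≼ y) → x ≼ y)

record GeometricLattice : Set₁ where
  field
    Carrier  : Set
    _≼_      : Carrier → Carrier → Set
    _∨_ _∧_  : Carrier → Carrier → Carrier
    𝟙 𝟘      : Carrier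
    isBoundedLattice : IsBoundedLattice _≡_ _≼_ _∨_ _∧_ 𝟙 𝟘
    elements : List Carrier
    complete : ∀ x → x ∈ elements
    -- decidability (automatic classically for a finite lattice; needed constructively)
    _≟_  : ∀ (x y : Carrier) → Dec (x ≡ y)
    _≼?_ : ∀ x y → Dec (x ≼ y)

  open Order _≼_ 𝟘 public

  field
    chains-equal : ∀ x y k l → MaxChain x y k → MaxChain x y l → k ≡ l
    -- the rank function  rk x = length of a maximal chain from 𝟘 to x  is submodular
    submodular : ∀ x y kx ky kj km →
      MaxChain 𝟘 x kx → MaxChain 𝟘 y ky →
      MaxChain 𝟘 (x ∨ y) kj → MaxChain 𝟘 (x ∧ y) km →
      kj + km ≤ kx + ky
    atomistic : ∀ x → Σ (Carrier → Set) λ S → (∀ a → S a → IsAtom a) × IsLub S x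

module _ (L : GeometricLattice) where
  open GeometricLattice L

  ⋁ : List Carrier → Carrier
  ⋁ = foldr _∨_ 𝟘

  InFact : (Carrier → Set) → Carrier → Carrier → Set
  InFact 𝒢 X F = 𝒢 F × F ≼ X × (∀ H → 𝒢 H → F ≼ H → H ≼ X → H ≡ F)

  -- the join map  ∏_{F ∈ fs} [𝟘, F] → [𝟘, X]  (fs an enumeration of Fact_𝒢(X))
  -- is a poset isomorphism: surjective and an order embedding
  -- (product order = componentwise order)
  JoinMapIso : List Carrier → Carrier → Set
  JoinMapIso fs X =
    (∀ z → z ≼ X → Σ (List Carrier) λ ys → Pointwise _≼_ ys fs × ⋁ ys ≡ z)
    × (∀ ys ys' → Pointwise _≼_ ys fs → Pointwise _≼_ ys' fs →
         (⋁ ys ≼ ⋁ ys') ⇔ Pointwise _≼_ ys ys')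

  IsBuildingSet : (Carrier → Set) → Set
  IsBuildingSet 𝒢 =
    (¬ 𝒢 𝟘) ×
    (∀ X fs → Unique fs → (∀ F → (F ∈ fs) ⇔ InFact 𝒢 X F) → JoinMapIso fs X)

  Incomparable : Carrier → Carrier → Set
  Incomparable a b = ¬ (a ≼ b) × ¬ (b ≼ a)

  IsAntichain : (Carrier → Set) → Set
  IsAntichain S = ∀ a b → S a → S b → a ≢ b → Incomparable a b

  -- S ⊆ 𝒢 is nested: no antichain A ⊆ S with |A| ≥ 2 has ⋁ A ∈ 𝒢
  -- (finite antichains are listed; pairwise incomparable implies distinct)
  IsNested : (Carrier → Set) → (Carrier → Set) → Set
  IsNested 𝒢 S =
    (∀ F → S F → 𝒢 F) ×
    (∀ as → All S as → AllPairs Incomparable as → 2 ≤ length as → ¬ 𝒢 (⋁ as))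

record DirectedBuiltLattice : Set₁ where
  field
    L : GeometricLattice
  open GeometricLattice L public
  field
    𝒢 : Carrier → Set
    isBuildingSet : IsBuildingSet L 𝒢
    _◁_ : Carrier → Carrier → Set
    ◁-irrefl : ∀ a → IsAtom a → ¬ (a ◁ a)
    ◁-trans  : ∀ a b c → IsAtom a → IsAtom b → IsAtom c → a ◁ b → b ◁ c → a ◁ c
    _◁?_     : ∀ a b → Dec (a ◁ b)
    ◁-total  : ∀ a b → IsAtom a → IsAtom b → (a ◁ b) ⊎ (a ≡ b) ⊎ (b ◁ a)

  IsWord : Carrier → List Carrier → Set
  IsWord X w = AllPairs _◁_ w × (∀ a → (a ∈ w) ⇔ (IsAtom a × a ≼ X))

  data LexLt : List Carrier → List Carrier → Set where
    here  : ∀ {a b as bs} → a ◁ b → LexLt (a ∷ as) (b ∷ bs)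
    there : ∀ {a as bs} → LexLt as bs → LexLt (a ∷ as) (a ∷ bs)

  IsPrefix : List Carrier → List Carrier → Set
  IsPrefix u v = Σ (List Carrier) λ s → v ≡ u ++ s

  _◁*_ : Carrier → Carrier → Set
  X₁ ◁* X₂ = ∀ w₁ w₂ → IsWord X₁ w₁ → IsWord X₂ w₂ →
             IsPrefix w₂ w₁ ⊎ LexLt w₁ w₂

  Fact : Carrier → Carrier → Set
  Fact X = InFact L 𝒢 X

  Disjoint : (Carrier → Set) → (Carrier → Set) → Set
  Disjoint S T = ∀ F → S F → T F → ⊥

  _∪_ : (Carrier → Set) → (Carrier → Set) → Carrier → Set
  (S ∪ T) F = S F ⊎ T F

  IsNestedAntichain : (Carrier → Set) → Set
  IsNestedAntichain S = IsNested L 𝒢 S × IsAntichain L S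

-- Both sides depend only on sets of atoms: X₁ ◁* X₂ holds iff the ◁-least atom lying below
-- exactly one of X₁, X₂ (if there is one below X₂) lies below X₁. Under the hypotheses, the atoms
-- below G ∨ Gᵢ are the disjoint union of those below G and those below Gᵢ: by the building-set
-- axiom every factor of G ∨ Gᵢ is the join of the factors of G and of Gᵢ below it, so by
-- nestedness it lies below exactly one of them, and distinct factors of G ∨ Gᵢ share no atom.
-- Adding the same set of atoms, disjoint from both, to both sides does not change the least
-- element of their symmetric difference.

module Submission where

open import Defs hiding (⋁)
import Defs
open import Level using (0ℓ)
open import Function using (_∘_; id; const; case_of_; _⇔_; mk⇔; Equivalence)
open import Data.Product using (∃-syntax; _×_; _,_; proj₁; proj₂)
open import Data.Sum using (_⊎_; inj₁; inj₂; [_,_])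
import Data.Sum as Sum
open import Data.Empty using (⊥; ⊥-elim)
open import Data.Nat using (s≤s; z≤n)
open import Data.Unit using (tt)
open import Data.List using (List; []; _∷_; _++_; filter; map; foldr; deduplicate)
open import Data.List.Properties using (map-id)
open import Data.List.Membership.Propositional using (_∈_; _∉_)
open import Data.List.Membership.Propositional.Properties
  using (∈-filter⁺; ∈-filter⁻; ∈-map⁺; ∈-map⁻; ∈-deduplicate⁺; ∈-deduplicate⁻; ∈-++⁺ˡ; ∈-++⁺ʳ; ∈-++⁻)
open import Data.List.Relation.Unary.Any using (here; there)
open import Data.List.Relation.Unary.All using (All; []; _∷_; all?)
import Data.List.Relation.Unary.All as All
open import Data.List.Relation.Unary.AllPairs using (AllPairs; []; _∷_)
open import Data.List.Relation.Binary.Pointwise using (Pointwise; []; _∷_)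
open import Data.List.Relation.Unary.Unique.Propositional using (Unique)
import Data.List.Relation.Unary.Unique.Propositional.Properties as Unique
open import Data.List.Relation.Unary.Unique.DecPropositional.Properties using (deduplicate-!)
open import Relation.Nullary using (¬_; Dec; yes; no)
open import Relation.Nullary.Decidable
  using (map′; _×-dec_; _⊎-dec_; _→-dec_; ¬?; decidable-stable; ¬¬-excluded-middle)
open import Relation.Nullary.Negation using (¬¬-Monad)
open import Relation.Unary using (Pred; _≐_)
open import Relation.Unary.Properties using (≐-sym)
open import Relation.Binary.Lattice.Structures using (IsBoundedLattice)
open import Relation.Binary.Bundles using (Poset)
open import Relation.Binary.PropositionalEquality using (_≡_; _≢_; refl; sym; trans; cong; subst; subst₂)
import Relation.Binary.Reasoning.PartialOrder as PartialOrderReasoning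
open import Function.Properties.Equivalence using (⇔-setoid)

module FiniteLattice (L : GeometricLattice) where
  open GeometricLattice L
  open IsBoundedLattice isBoundedLattice public
    using (isPartialOrder; ∨-least)
    renaming (refl to ≼-refl; reflexive to ≼-reflexive; trans to ≼-trans; antisym to ≼-antisym;
              minimum to 𝟘-least; x≤x∨y to x≼x∨y; y≤x∨y to y≼x∨y)

  ⋁ : List Carrier → Carrier
  ⋁ = Defs.⋁ L

  poset : Poset 0ℓ 0ℓ 0ℓ
  poset = record { isPartialOrder = isPartialOrder }

  Atoms : Carrier → Pred Carrier 0ℓ
  Atoms X a = IsAtom a × a ≼ X

  atom⋠𝟘 : ∀ {a} → IsAtom a → ¬ a ≼ 𝟘
  atom⋠𝟘 (_ , 𝟘≢a , _) a≼𝟘 = 𝟘≢a (≼-antisym (𝟘-least _) a≼𝟘)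

  x≼⋁ : ∀ {x xs} → x ∈ xs → x ≼ ⋁ xs
  x≼⋁ {xs = y ∷ ys} (here refl) = x≼x∨y y (⋁ ys)
  x≼⋁ {xs = y ∷ ys} (there x∈ys) = ≼-trans (x≼⋁ x∈ys) (y≼x∨y y (⋁ ys))

  ⋁-least : ∀ {xs y} → (∀ {x} → x ∈ xs → x ≼ y) → ⋁ xs ≼ y
  ⋁-least {[]} _ = 𝟘-least _
  ⋁-least {x ∷ xs} ub = ∨-least (ub (here refl)) (⋁-least (ub ∘ there))

  ⋁-mono : ∀ {xs ys} → Pointwise _≼_ xs ys → ⋁ xs ≼ ⋁ ys
  ⋁-mono [] = ≼-refl
  ⋁-mono {x ∷ xs} {y ∷ ys} (x≼y ∷ xs≼ys) =
    ∨-least (≼-trans x≼y (x≼x∨y y (⋁ ys))) (≼-trans (⋁-mono xs≼ys) (y≼x∨y y (⋁ ys)))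

  ⋁-⊆ : ∀ {xs ys} → (∀ {x} → x ∈ xs → x ∈ ys) → ⋁ xs ≼ ⋁ ys
  ⋁-⊆ xs⊆ys = ⋁-least (x≼⋁ ∘ xs⊆ys)

  ∀? : {P : Carrier → Set} → (∀ x → Dec (P x)) → Dec (∀ x → P x)
  ∀? P? = map′ (λ all x → All.lookup all (complete x)) (λ ∀P → All.tabulate (λ {x} _ → ∀P x))
                (all? P? elements)

  IsAtom? : ∀ a → Dec (IsAtom a)
  IsAtom? a = (𝟘 ≼? a) ×-dec ¬? (𝟘 ≟ a) ×-dec
              ∀? (λ z → (𝟘 ≼? z) →-dec (z ≼? a) →-dec ((z ≟ 𝟘) ⊎-dec (z ≟ a)))

  ¬¬-decidable : (P : Carrier → Set) → ¬ ¬ (∀ x → Dec (P x))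
  ¬¬-decidable P ¬dec = ¬¬-all (λ decs → ¬dec (λ x → All.lookup decs (complete x)))
    where
      ¬¬-all : ¬ ¬ All (Dec ∘ P) elements
      ¬¬-all = All.mapM 0ℓ ¬¬-Monad (λ _ → ¬¬-excluded-middle) (All.universal (λ _ → tt) elements)

  private
    ascend : Carrier → List Carrier → Carrier
    ascend x [] = x
    ascend x (y ∷ ys) with x ≼? y
    ... | yes _ = ascend y ys
    ... | no _ = ascend x ys

    ≼-ascend : ∀ x ys → x ≼ ascend x ys
    ≼-ascend x [] = ≼-refl
    ≼-ascend x (y ∷ ys) with x ≼? y
    ... | yes x≼y = ≼-trans x≼y (≼-ascend y ys)
    ... | no _ = ≼-ascend x ys

    ascend-∈ : ∀ x ys → ascend x ys ∈ x ∷ ys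
    ascend-∈ x [] = here refl
    ascend-∈ x (y ∷ ys) with x ≼? y
    ... | yes _ = there (ascend-∈ y ys)
    ... | no _ with ascend-∈ x ys
    ...   | here eq = here eq
    ...   | there m∈ys = there (there m∈ys)

    ascend-maximal : ∀ x ys {z} → z ∈ ys → ascend x ys ≼ z → z ≡ ascend x ys
    ascend-maximal x (y ∷ ys) z∈ m≼z with x ≼? y | z∈
    ... | yes _ | here refl = ≼-antisym (≼-ascend y ys) m≼z
    ... | yes _ | there z∈ys = ascend-maximal y ys z∈ys m≼z
    ... | no x⋠y | here refl = ⊥-elim (x⋠y (≼-trans (≼-ascend x ys) m≼z))
    ... | no _ | there z∈ys = ascend-maximal x ys z∈ys m≼z

  below-maximal : {P : Carrier → Set} → (∀ x → Dec (P x)) → ∀ {x} → P x →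
                  ∃[ m ] P m × x ≼ m × (∀ y → P y → m ≼ y → y ≡ m)
  below-maximal {P} P? {x} Px = m , Pm (ascend-∈ x candidates) , ≼-ascend x candidates , maximal
    where
      candidates = filter P? elements
      m = ascend x candidates
      Pm : ∀ {y} → y ∈ x ∷ candidates → P y
      Pm (here refl) = Px
      Pm (there y∈) = proj₂ (∈-filter⁻ P? {xs = elements} y∈)
      maximal : ∀ y → P y → m ≼ y → y ≡ m
      maximal y Py = ascend-maximal x candidates (∈-filter⁺ P? (complete y) Py)

  _[_≔_] : (Carrier → Carrier) → Carrier → Carrier → Carrier → Carrier
  (k [ F ≔ u ]) f with f ≟ F
  ... | yes _ = u
  ... | no _ = k f

  [≔]-elim : ∀ (P : Carrier → Set) {k F u f} → (f ≡ F → P u) → (f ≢ F → P (k f)) → P ((k [ F ≔ u ]) f)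
  [≔]-elim P {F = F} {f = f} at elsewhere with f ≟ F
  ... | yes f≡F = at f≡F
  ... | no f≢F = elsewhere f≢F

  [≔]-at : ∀ {k F u} → (k [ F ≔ u ]) F ≡ u
  [≔]-at {k} {F} {u} = [≔]-elim (_≡ u) (λ _ → refl) (λ F≢F → ⊥-elim (F≢F refl))

  [≔]-elsewhere : ∀ {k F u f} → f ≢ F → (k [ F ≔ u ]) f ≡ k f
  [≔]-elsewhere {k} {f = f} f≢F = [≔]-elim (_≡ k f) (λ f≡F → ⊥-elim (f≢F f≡F)) (λ _ → refl)

  joinMap-reflects-≼ : ∀ {fs X} → JoinMapIso L fs X → ∀ {g h : Carrier → Carrier} →
                       (∀ {f} → f ∈ fs → g f ≼ f) → (∀ {f} → f ∈ fs → h f ≼ f) →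
                       ⋁ (map g fs) ≼ ⋁ (map h fs) → ∀ {f} → f ∈ fs → g f ≼ h f
  joinMap-reflects-≼ {fs} (_ , embedding) {g} {h} g≼ h≼ ⋁g≼⋁h =
    lookup fs (Equivalence.to (embedding _ _ (below fs g≼) (below fs h≼)) ⋁g≼⋁h)
    where
      below : ∀ xs {k : Carrier → Carrier} → (∀ {f} → f ∈ xs → k f ≼ f) → Pointwise _≼_ (map k xs) xs
      below [] _ = []
      below (x ∷ xs) k≼ = k≼ (here refl) ∷ below xs (k≼ ∘ there)
      lookup : ∀ xs → Pointwise _≼_ (map g xs) (map h xs) → ∀ {f} → f ∈ xs → g f ≼ h f
      lookup (x ∷ xs) (gx≼hx ∷ _) (here refl) = gx≼hx
      lookup (x ∷ xs) (_ ∷ rest) (there f∈xs) = lookup xs rest f∈xs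

  joinMapIso-disjoint : ∀ {fs X F₁ F₂ a} → JoinMapIso L fs X → F₁ ∈ fs → F₂ ∈ fs → F₁ ≢ F₂ →
                        a ≼ F₁ → a ≼ F₂ → a ≼ 𝟘
  joinMapIso-disjoint {fs} {F₁ = F₁} {F₂} {a} iso F₁∈ F₂∈ F₁≢F₂ a≼F₁ a≼F₂ =
    subst₂ _≼_ [≔]-at ([≔]-elsewhere F₁≢F₂)
           (joinMap-reflects-≼ iso (spike≼ a≼F₁) (spike≼ a≼F₂) spikes≼ F₁∈)
    where
      spike : Carrier → Carrier → Carrier
      spike F = const 𝟘 [ F ≔ a ]
      spike≼ : ∀ {F} → a ≼ F → ∀ {f} → f ∈ fs → spike F f ≼ f
      spike≼ a≼F {f} _ = [≔]-elim (_≼ f) (λ { refl → a≼F }) (λ _ → 𝟘-least f)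
      spikes≼ : ⋁ (map (spike F₁) fs) ≼ ⋁ (map (spike F₂) fs)
      spikes≼ = ⋁-least {map (spike F₁) fs} λ y∈ → case ∈-map⁻ (spike F₁) {xs = fs} y∈ of λ where
        (f , _ , refl) → ≼-trans ([≔]-elim (_≼ a) (λ _ → ≼-refl) (λ _ → 𝟘-least a))
                                 (subst (_≼ ⋁ (map (spike F₂) fs)) [≔]-at (x≼⋁ (∈-map⁺ (spike F₂) F₂∈)))

-- P ◁ˢ Q: the ◁-least element of the symmetric difference of P and Q, if there is one, lies in P.
-- On the atom sets of X₁ and X₂ this is exactly X₁ ◁* X₂.
module SetLex {A : Set} (_◁_ : A → A → Set) where
  open import Relation.Unary using (_∪_)

  _◁ˢ_ : Pred A 0ℓ → Pred A 0ℓ → Set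
  P ◁ˢ Q = ∀ {b} → Q b → ¬ P b → ∃[ a ] P a × ¬ Q a × a ◁ b

  ◁ˢ-resp-≐ : ∀ {P P′ Q Q′} → P ≐ P′ → Q ≐ Q′ → P ◁ˢ Q → P′ ◁ˢ Q′
  ◁ˢ-resp-≐ (P⊆P′ , P′⊆P) (Q⊆Q′ , Q′⊆Q) P◁Q Q′b ¬P′b with P◁Q (Q′⊆Q Q′b) (¬P′b ∘ P⊆P′)
  ... | a , Pa , ¬Qa , a◁b = a , P⊆P′ Pa , ¬Qa ∘ Q′⊆Q , a◁b

  ◁ˢ-cong : ∀ {P P′ Q Q′} → P ≐ P′ → Q ≐ Q′ → P ◁ˢ Q ⇔ P′ ◁ˢ Q′
  ◁ˢ-cong P≐P′ Q≐Q′ = mk⇔ (◁ˢ-resp-≐ P≐P′ Q≐Q′) (◁ˢ-resp-≐ (≐-sym P≐P′) (≐-sym Q≐Q′))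

  ◁ˢ⇔∪-disjoint : ∀ {P Q R} → (∀ {a} → R a → ¬ P a) → (∀ {a} → R a → ¬ Q a) →
                  P ◁ˢ Q ⇔ (R ∪ P) ◁ˢ (R ∪ Q)
  ◁ˢ⇔∪-disjoint {P} {Q} {R} R∩P=∅ R∩Q=∅ = mk⇔ to from
    where
      to : P ◁ˢ Q → (R ∪ P) ◁ˢ (R ∪ Q)
      to P◁Q RQb ¬RPb with P◁Q ([ ⊥-elim ∘ ¬RPb ∘ inj₁ , id ] RQb) (¬RPb ∘ inj₂)
      ... | a , Pa , ¬Qa , a◁b = a , inj₂ Pa , [ (λ Ra → R∩P=∅ Ra Pa) , ¬Qa ] , a◁b
      from : (R ∪ P) ◁ˢ (R ∪ Q) → P ◁ˢ Q
      from RP◁RQ Qb ¬Pb with RP◁RQ (inj₂ Qb) [ (λ Rb → R∩Q=∅ Rb Qb) , ¬Pb ]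
      ... | a , RPa , ¬RQa , a◁b = a , [ ⊥-elim ∘ ¬RQa ∘ inj₁ , id ] RPa , ¬RQa ∘ inj₂ , a◁b

module Words (D : DirectedBuiltLattice) where
  open DirectedBuiltLattice D
    using (Carrier; _≼_; _≟_; _≼?_; elements; complete; IsAtom;
           _◁_; ◁-irrefl; ◁-trans; _◁?_; ◁-total; IsWord; IsPrefix; LexLt; here; there; _◁*_)
  open FiniteLattice (DirectedBuiltLattice.L D) using (Atoms; IsAtom?)
  open SetLex _◁_

  Sorted : List Carrier → Set
  Sorted u = AllPairs _◁_ u × All IsAtom u

  ◁-asym : ∀ {a b} → IsAtom a → IsAtom b → a ◁ b → ¬ b ◁ a
  ◁-asym {a} {b} atom-a atom-b a◁b b◁a = ◁-irrefl a atom-a (◁-trans a b a atom-a atom-b atom-a a◁b b◁a)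

  ◁-sorted : ∀ {a b bs} → IsAtom a → Sorted (b ∷ bs) → a ◁ b → All (a ◁_) (b ∷ bs)
  ◁-sorted {a} {b} atom-a (b◁bs ∷ _ , atom-b ∷ atoms) a◁b =
    a◁b ∷ All.zipWith (λ (b◁c , atom-c) → ◁-trans a b _ atom-a atom-b atom-c a◁b b◁c) (b◁bs , atoms)

  ◁-all⇒∉ : ∀ {a u} → IsAtom a → All (a ◁_) u → a ∉ u
  ◁-all⇒∉ {a} atom-a a◁u a∈u = ◁-irrefl a atom-a (All.lookup a◁u a∈u)

  insert : Carrier → List Carrier → List Carrier
  insert x [] = x ∷ []
  insert x (y ∷ ys) with x ≟ y
  ... | yes _ = y ∷ ys
  ... | no _ with x ◁? y
  ...   | yes _ = x ∷ y ∷ ys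
  ...   | no _ = y ∷ insert x ys

  ∈-insert⁻ : ∀ {z} x ys → z ∈ insert x ys → z ≡ x ⊎ z ∈ ys
  ∈-insert⁻ x [] (here z≡x) = inj₁ z≡x
  ∈-insert⁻ x (y ∷ ys) z∈ with x ≟ y
  ... | yes _ = inj₂ z∈
  ... | no _ with x ◁? y | z∈
  ...   | yes _ | here z≡x = inj₁ z≡x
  ...   | yes _ | there z∈ys = inj₂ z∈ys
  ...   | no _ | here z≡y = inj₂ (here z≡y)
  ...   | no _ | there z∈ins = Sum.map₂ there (∈-insert⁻ x ys z∈ins)

  ∈-insert⁺ : ∀ {z} x ys → z ≡ x ⊎ z ∈ ys → z ∈ insert x ys
  ∈-insert⁺ x [] (inj₁ z≡x) = here z≡x
  ∈-insert⁺ x (y ∷ ys) z∈ with x ≟ y | z∈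
  ... | yes refl | inj₁ z≡x = here z≡x
  ... | yes _ | inj₂ z∈ys = z∈ys
  ... | no _ | _ with x ◁? y | z∈
  ...   | yes _ | inj₁ z≡x = here z≡x
  ...   | yes _ | inj₂ z∈ys = there z∈ys
  ...   | no _ | inj₂ (here z≡y) = here z≡y
  ...   | no _ | inj₂ (there z∈ys) = there (∈-insert⁺ x ys (inj₂ z∈ys))
  ...   | no _ | inj₁ z≡x = there (∈-insert⁺ x ys (inj₁ z≡x))

  insert-sorted : ∀ {x ys} → IsAtom x → Sorted ys → Sorted (insert x ys)
  insert-sorted {x} {[]} atom-x _ = [] ∷ [] , atom-x ∷ []
  insert-sorted {x} {y ∷ ys} atom-x (y◁ys ∷ ys-sorted , atom-y ∷ atoms) with x ≟ y
  ... | yes _ = y◁ys ∷ ys-sorted , atom-y ∷ atoms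
  ... | no x≢y with x ◁? y
  ...   | yes x◁y = ◁-sorted atom-x (y◁ys ∷ ys-sorted , atom-y ∷ atoms) x◁y ∷ y◁ys ∷ ys-sorted ,
                    atom-x ∷ atom-y ∷ atoms
  ...   | no x⋪y = All.tabulate y◁insert ∷ proj₁ rest , atom-y ∷ proj₂ rest
    where
      rest = insert-sorted atom-x (ys-sorted , atoms)
      y◁x : y ◁ x
      y◁x with ◁-total x y atom-x atom-y
      ... | inj₁ x◁y = ⊥-elim (x⋪y x◁y)
      ... | inj₂ (inj₁ x≡y) = ⊥-elim (x≢y x≡y)
      ... | inj₂ (inj₂ y◁x) = y◁x
      y◁insert : ∀ {z} → z ∈ insert x ys → y ◁ z
      y◁insert z∈ with ∈-insert⁻ x ys z∈
      ... | inj₁ refl = y◁x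
      ... | inj₂ z∈ys = All.lookup y◁ys z∈ys

  sort : List Carrier → List Carrier
  sort = foldr insert []

  ∈-sort⁻ : ∀ xs {z} → z ∈ sort xs → z ∈ xs
  ∈-sort⁻ (x ∷ xs) z∈ = [ here , there ∘ ∈-sort⁻ xs ] (∈-insert⁻ x (sort xs) z∈)

  ∈-sort⁺ : ∀ xs {z} → z ∈ xs → z ∈ sort xs
  ∈-sort⁺ (x ∷ xs) (here z≡x) = ∈-insert⁺ x (sort xs) (inj₁ z≡x)
  ∈-sort⁺ (x ∷ xs) (there z∈xs) = ∈-insert⁺ x (sort xs) (inj₂ (∈-sort⁺ xs z∈xs))

  sort-sorted : ∀ xs → (∀ {a} → a ∈ xs → IsAtom a) → Sorted (sort xs)
  sort-sorted [] _ = [] , []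
  sort-sorted (x ∷ xs) atomic = insert-sorted (atomic (here refl)) (sort-sorted xs (atomic ∘ there))

  word-exists : ∀ X → ∃[ w ] IsWord X w
  word-exists X = sort atoms , proj₁ (sort-sorted atoms (proj₁ ∘ atoms⊆)) ,
                  λ a → mk⇔ (atoms⊆ ∘ ∈-sort⁻ atoms) (∈-sort⁺ atoms ∘ ∈-filter⁺ Atoms? (complete a))
    where
      Atoms? : ∀ a → Dec (Atoms X a)
      Atoms? a = IsAtom? a ×-dec (a ≼? X)
      atoms = filter Atoms? elements
      atoms⊆ : ∀ {a} → a ∈ atoms → Atoms X a
      atoms⊆ = proj₂ ∘ ∈-filter⁻ Atoms? {xs = elements}

  lex⇒◁ˢ : ∀ {u v} → Sorted u → Sorted v → IsPrefix v u ⊎ LexLt u v → (_∈ u) ◁ˢ (_∈ v)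
  lex⇒◁ˢ _ _ (inj₁ (s , refl)) b∈v b∉u = ⊥-elim (b∉u (∈-++⁺ˡ b∈v))
  lex⇒◁ˢ {a ∷ _} (_ , atom-a ∷ _) v-sorted (inj₂ (here a◁b)) b∈v _ =
    a , here refl , ◁-all⇒∉ atom-a a◁v , All.lookup a◁v b∈v
    where a◁v = ◁-sorted atom-a v-sorted a◁b
  lex⇒◁ˢ {a ∷ as} {.a ∷ bs} (a◁as ∷ as-sorted , atom-a ∷ as-atoms) (_ ∷ bs-sorted , _ ∷ bs-atoms)
         (inj₂ (there as<bs)) b∈v b∉u with b∈v
  ... | here refl = ⊥-elim (b∉u (here refl))
  ... | there b∈bs
    with lex⇒◁ˢ (as-sorted , as-atoms) (bs-sorted , bs-atoms) (inj₂ as<bs) b∈bs (b∉u ∘ there)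
  ...   | c , c∈as , c∉bs , c◁b = c , there c∈as , c∉a∷bs , c◁b
    where c∉a∷bs : c ∉ a ∷ bs
          c∉a∷bs (here refl) = ◁-irrefl a atom-a (All.lookup a◁as c∈as)
          c∉a∷bs (there c∈bs) = c∉bs c∈bs

  ◁ˢ⇒lex : ∀ {u v} → Sorted u → Sorted v → (_∈ u) ◁ˢ (_∈ v) → IsPrefix v u ⊎ LexLt u v
  ◁ˢ⇒lex {u} {[]} _ _ _ = inj₁ (u , refl)
  ◁ˢ⇒lex {[]} {b ∷ _} _ _ u◁v with u◁v (here refl) (λ ())
  ... | _ , () , _
  ◁ˢ⇒lex {a ∷ as} {b ∷ bs} (a◁as ∷ as-sorted , atom-a ∷ as-atoms) (b◁bs ∷ bs-sorted , atom-b ∷ bs-atoms)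
         u◁v
    with ◁-total a b atom-a atom-b
  ... | inj₁ a◁b = inj₂ (here a◁b)
  ... | inj₂ (inj₂ b◁a) =
    let b◁u = ◁-sorted atom-b (a◁as ∷ as-sorted , atom-a ∷ as-atoms) b◁a
        c , c∈u , _ , c◁b = u◁v (here refl) (◁-all⇒∉ atom-b b◁u)
    in ⊥-elim (◁-asym (All.lookup (atom-a ∷ as-atoms) c∈u) atom-b c◁b (All.lookup b◁u c∈u))
  ◁ˢ⇒lex {a ∷ as} {.a ∷ bs} (a◁as ∷ as-sorted , atom-a ∷ as-atoms) (a◁bs ∷ bs-sorted , _ ∷ bs-atoms)
         u◁v
    | inj₂ (inj₁ refl) =
    Sum.map (λ (s , bs≡as++s) → s , cong (a ∷_) bs≡as++s) there
            (◁ˢ⇒lex (as-sorted , as-atoms) (bs-sorted , bs-atoms) tails◁)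
    where
      tails◁ : (_∈ as) ◁ˢ (_∈ bs)
      tails◁ {b} b∈bs b∉as with u◁v (there b∈bs) b∉a∷as
        where b∉a∷as : b ∉ a ∷ as
              b∉a∷as (here refl) = ◁-irrefl a atom-a (All.lookup a◁bs b∈bs)
              b∉a∷as (there b∈as) = b∉as b∈as
      ... | c , here refl , c∉v , _ = ⊥-elim (c∉v (here refl))
      ... | c , there c∈as , c∉v , c◁b = c , c∈as , c∉v ∘ there , c◁b

  word-sorted : ∀ {X w} → IsWord X w → Sorted w
  word-sorted (w◁ , w≐) = w◁ , All.tabulate (proj₁ ∘ Equivalence.to (w≐ _))

  word≐atoms : ∀ {X w} → IsWord X w → (_∈ w) ≐ Atoms X
  word≐atoms (_ , w≐) = Equivalence.to (w≐ _) , Equivalence.from (w≐ _)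

  ◁*⇔◁ˢ : ∀ X₁ X₂ → X₁ ◁* X₂ ⇔ Atoms X₁ ◁ˢ Atoms X₂
  ◁*⇔◁ˢ X₁ X₂ = mk⇔ to from
    where
      to : X₁ ◁* X₂ → Atoms X₁ ◁ˢ Atoms X₂
      to X₁◁*X₂ =
        let w₁ , w₁-word = word-exists X₁
            w₂ , w₂-word = word-exists X₂
        in Equivalence.to (◁ˢ-cong (word≐atoms w₁-word) (word≐atoms w₂-word))
             (lex⇒◁ˢ (word-sorted w₁-word) (word-sorted w₂-word) (X₁◁*X₂ w₁ w₂ w₁-word w₂-word))
      from : Atoms X₁ ◁ˢ Atoms X₂ → X₁ ◁* X₂
      from atoms◁ w₁ w₂ w₁-word w₂-word =
        ◁ˢ⇒lex (word-sorted w₁-word) (word-sorted w₂-word)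
               (Equivalence.from (◁ˢ-cong (word≐atoms w₁-word) (word≐atoms w₂-word)) atoms◁)

module BuildingSet (L : GeometricLattice) {𝒢 : GeometricLattice.Carrier L → Set}
                   (isBuildingSet : IsBuildingSet L 𝒢) where
  open import Relation.Unary using (_∪_)
  open GeometricLattice L
  open FiniteLattice L

  Fact : Carrier → Carrier → Set
  Fact = InFact L 𝒢

  𝟘∉𝒢 : ¬ 𝒢 𝟘
  𝟘∉𝒢 = proj₁ isBuildingSet

  fact≼ : ∀ {X F} → Fact X F → F ≼ X
  fact≼ = proj₁ ∘ proj₂

  IsNestedAntichain : Pred Carrier 0ℓ → Set
  IsNestedAntichain S = IsNested L 𝒢 S × IsAntichain L S

  nested-join-singleton : ∀ {S} → IsNested L 𝒢 S → IsAntichain L S →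
                          ∀ {ns} → All S ns → Unique ns → 𝒢 (⋁ ns) → ∃[ n ] ns ≡ n ∷ []
  nested-join-singleton _ _ {[]} _ _ 𝒢𝟘 = ⊥-elim (𝟘∉𝒢 𝒢𝟘)
  nested-join-singleton _ _ {n ∷ []} _ _ _ = n , refl
  nested-join-singleton {S} (_ , nested) antichain {ns@(_ ∷ _ ∷ _)} ns⊆S ns-unique 𝒢⋁ns =
    ⊥-elim (nested ns ns⊆S (incomparable ns⊆S ns-unique) (s≤s (s≤s z≤n)) 𝒢⋁ns)
    where
      incomparable : ∀ {xs} → All S xs → Unique xs → AllPairs (Incomparable L) xs
      incomparable [] [] = []
      incomparable (Sx ∷ Sxs) (x≢xs ∷ xs-unique) =
        All.zipWith (λ (Sy , x≢y) → antichain _ _ Sx Sy x≢y) (Sxs , x≢xs) ∷ incomparable Sxs xs-unique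

  module Decidable (𝒢? : ∀ x → Dec (𝒢 x)) where

    Fact? : ∀ X F → Dec (Fact X F)
    Fact? X F = 𝒢? F ×-dec (F ≼? X) ×-dec
                ∀? (λ H → 𝒢? H →-dec (F ≼? H) →-dec (H ≼? X) →-dec (H ≟ F))

    factors : Carrier → List Carrier
    factors X = deduplicate _≟_ (filter (Fact? X) elements)

    ∈-factors⁻ : ∀ {X F} → F ∈ factors X → Fact X F
    ∈-factors⁻ {X} = proj₂ ∘ ∈-filter⁻ (Fact? X) {xs = elements} ∘ ∈-deduplicate⁻ _≟_ _

    ∈-factors⁺ : ∀ {X F} → Fact X F → F ∈ factors X
    ∈-factors⁺ {X} {F} = ∈-deduplicate⁺ _≟_ ∘ ∈-filter⁺ (Fact? X) (complete F)

    factors-iso : ∀ {X} → JoinMapIso L (factors X) X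
    factors-iso {X} =
      proj₂ isBuildingSet X (factors X) (deduplicate-! _≟_ _) (λ _ → mk⇔ ∈-factors⁻ ∈-factors⁺)

    ≼⋁factors : ∀ {X} → X ≼ ⋁ (factors X)
    ≼⋁factors {X} with proj₁ factors-iso X ≼-refl
    ... | ys , ys≼factors , ⋁ys≡X = subst (_≼ ⋁ (factors X)) ⋁ys≡X (⋁-mono ys≼factors)

    below-factor : ∀ {X n} → 𝒢 n → n ≼ X → ∃[ F ] Fact X F × n ≼ F
    below-factor {X} 𝒢n n≼X with below-maximal (λ x → 𝒢? x ×-dec x ≼? X) (𝒢n , n≼X)
    ... | F , (𝒢F , F≼X) , n≼F , maximal =
      F , (𝒢F , F≼X , λ H 𝒢H F≼H H≼X → maximal H (𝒢H , H≼X) F≼H) , n≼F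

    -- An atom a ∉ 𝒢 would have no factors, so [𝟘, a] would be the one-point product.
    atom∈𝒢 : ∀ {a} → IsAtom a → 𝒢 a
    atom∈𝒢 {a} atom with 𝒢? a
    ... | yes 𝒢a = 𝒢a
    ... | no a∉𝒢 = ⊥-elim (atom⋠𝟘 atom (≼-trans ≼⋁factors (⋁-least (⊥-elim ∘ no-factor ∘ ∈-factors⁻))))
      where
        no-factor : ∀ {F} → ¬ Fact a F
        no-factor {F} (𝒢F , F≼a , _) with proj₂ (proj₂ atom) F (𝟘-least F) F≼a
        ... | inj₁ refl = 𝟘∉𝒢 𝒢F
        ... | inj₂ refl = a∉𝒢 𝒢F

    factors-share-no-atom : ∀ {X F₁ F₂ a} → Fact X F₁ → Fact X F₂ → F₁ ≢ F₂ →
                            IsAtom a → a ≼ F₁ → a ≼ F₂ → ⊥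
    factors-share-no-atom F₁-fact F₂-fact F₁≢F₂ atom a≼F₁ a≼F₂ =
      atom⋠𝟘 atom (joinMapIso-disjoint factors-iso (∈-factors⁺ F₁-fact) (∈-factors⁺ F₂-fact)
                                       F₁≢F₂ a≼F₁ a≼F₂)

    -- Replacing F in the tuple of factors by z, the join of the n ∈ ns below F, still gives a
    -- tuple whose join is ≥ X, because every other n lies below another factor; the embedding
    -- half of the building-set axiom then compares the tuples coordinatewise.
    factor≼⋁below : ∀ {X F} ns → (∀ {n} → n ∈ ns → 𝒢 n × n ≼ X) → X ≼ ⋁ ns →
                    Fact X F → F ≼ ⋁ (filter (_≼? F) ns)
    factor≼⋁below {X} {F} ns ns⊆ X≼⋁ns F-fact =
      subst (F ≼_) [≔]-at (joinMap-reflects-≼ factors-iso (λ _ → ≼-refl) raise≼ factors≼raised F∈)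
      where
        fs = factors X
        F∈ = ∈-factors⁺ F-fact
        z = ⋁ (filter (_≼? F) ns)
        raise = id [ F ≔ z ]
        raised = ⋁ (map raise fs)
        raise≼ : ∀ {f} → f ∈ fs → raise f ≼ f
        raise≼ {f} _ = [≔]-elim (_≼ f) (λ { refl → ⋁-least (proj₂ ∘ ∈-filter⁻ (_≼? F) {xs = ns}) })
                                       (λ _ → ≼-refl)
        ≼raised : ∀ {f} → f ∈ fs → raise f ≼ raised
        ≼raised = x≼⋁ ∘ ∈-map⁺ raise
        ns≼raised : ∀ {n} → n ∈ ns → n ≼ raised
        ns≼raised {n} n∈ns with n ≼? F
        ... | yes n≼F =
          ≼-trans (x≼⋁ (∈-filter⁺ (_≼? F) n∈ns n≼F)) (subst (_≼ raised) [≔]-at (≼raised F∈))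
        ... | no n⋠F with below-factor (proj₁ (ns⊆ n∈ns)) (proj₂ (ns⊆ n∈ns))
        ...   | F′ , F′-fact , n≼F′ =
          ≼-trans n≼F′ (subst (_≼ raised) ([≔]-elsewhere (λ { refl → n⋠F n≼F′ }))
                                         (≼raised (∈-factors⁺ F′-fact)))
        factors≼raised : ⋁ (map id fs) ≼ raised
        factors≼raised = begin
          ⋁ (map id fs) ≡⟨ cong ⋁ (map-id fs) ⟩
          ⋁ fs          ≤⟨ ⋁-least (fact≼ ∘ ∈-factors⁻) ⟩
          X             ≤⟨ X≼⋁ns ⟩
          ⋁ ns          ≤⟨ ⋁-least ns≼raised ⟩
          raised        ∎
          where open PartialOrderReasoning poset

    module Join {G H} (disjoint : ∀ F → Fact H F → Fact G F → ⊥)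
                (nestedAntichain : IsNestedAntichain (Fact H ∪ Fact G)) where

      private
        X = G ∨ H
        ns = factors G ++ factors H

        ∈ns⇒fact : ∀ {n} → n ∈ ns → Fact G n ⊎ Fact H n
        ∈ns⇒fact = Sum.map ∈-factors⁻ ∈-factors⁻ ∘ ∈-++⁻ (factors G)

        ns-unique : Unique ns
        ns-unique = Unique.++⁺ (deduplicate-! _≟_ _) (deduplicate-! _≟_ _)
                               (λ (n∈G , n∈H) → disjoint _ (∈-factors⁻ n∈H) (∈-factors⁻ n∈G))

        ns⊆𝒢∩[𝟘,X] : ∀ {n} → n ∈ ns → 𝒢 n × n ≼ X
        ns⊆𝒢∩[𝟘,X] n∈ns with ∈ns⇒fact n∈ns
        ... | inj₁ n-fact = proj₁ n-fact , ≼-trans (fact≼ n-fact) (x≼x∨y G H)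
        ... | inj₂ n-fact = proj₁ n-fact , ≼-trans (fact≼ n-fact) (y≼x∨y G H)

        X≼⋁ns : X ≼ ⋁ ns
        X≼⋁ns = ∨-least (≼-trans ≼⋁factors (⋁-⊆ {factors G} ∈-++⁺ˡ))
                        (≼-trans ≼⋁factors (⋁-⊆ {factors H} (∈-++⁺ʳ (factors G))))

      -- The n ∈ ns below F join to F ∈ 𝒢, so by nestedness there is exactly one of them.
      factor-below-unique : ∀ {F} → Fact X F →
                            ∃[ n ] n ∈ ns × F ≼ n × (∀ {m} → m ∈ ns → m ≼ F → m ≡ n)
      factor-below-unique {F} F-fact =
        n , proj₁ (below⊆ n∈below) , F≼n , λ m∈ns m≼F → ∈below⇒≡n (∈-filter⁺ (_≼? F) m∈ns m≼F)
        where
          below = filter (_≼? F) ns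
          below⊆ : ∀ {m} → m ∈ below → m ∈ ns × m ≼ F
          below⊆ = ∈-filter⁻ (_≼? F) {xs = ns}
          ⋁below≡F : ⋁ below ≡ F
          ⋁below≡F = ≼-antisym (⋁-least (proj₂ ∘ below⊆)) (factor≼⋁below ns ns⊆𝒢∩[𝟘,X] X≼⋁ns F-fact)
          singleton : ∃[ n ] below ≡ n ∷ []
          singleton = nested-join-singleton (proj₁ nestedAntichain) (proj₂ nestedAntichain)
                        (All.tabulate (Sum.swap ∘ ∈ns⇒fact ∘ proj₁ ∘ below⊆))
                        (Unique.filter⁺ (_≼? F) ns-unique) (subst 𝒢 (sym ⋁below≡F) (proj₁ F-fact))
          n = proj₁ singleton
          ∈below⇒≡n : ∀ {m} → m ∈ below → m ≡ n
          ∈below⇒≡n m∈below with subst (_ ∈_) (proj₂ singleton) m∈below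
          ... | here m≡n = m≡n
          n∈below : n ∈ below
          n∈below = subst (n ∈_) (sym (proj₂ singleton)) (here refl)
          F≼n : F ≼ n
          F≼n = subst (_≼ n) ⋁below≡F (⋁-least (≼-reflexive ∘ ∈below⇒≡n))

      atom≼∨ : ∀ {a} → IsAtom a → a ≼ (G ∨ H) → a ≼ G ⊎ a ≼ H
      atom≼∨ atom a≼X =
        let F , F-fact , a≼F = below-factor (atom∈𝒢 atom) a≼X
            n , n∈ns , F≼n , _ = factor-below-unique F-fact
            a≼n = ≼-trans a≼F F≼n
        in Sum.map (≼-trans a≼n ∘ fact≼) (≼-trans a≼n ∘ fact≼) (∈ns⇒fact n∈ns)

      no-common-atom : ∀ {a} → IsAtom a → a ≼ G → a ≼ H → ⊥
      no-common-atom atom a≼G a≼H =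
        let g , g-fact , a≼g = below-factor (atom∈𝒢 atom) a≼G
            h , h-fact , a≼h = below-factor (atom∈𝒢 atom) a≼H
            F₁ , F₁-fact , g≼F₁ = below-factor (proj₁ g-fact) (≼-trans (fact≼ g-fact) (x≼x∨y G H))
            F₂ , F₂-fact , h≼F₂ = below-factor (proj₁ h-fact) (≼-trans (fact≼ h-fact) (y≼x∨y G H))
        in case F₁ ≟ F₂ of λ where
          (no F₁≢F₂) →
            factors-share-no-atom F₁-fact F₂-fact F₁≢F₂ atom (≼-trans a≼g g≼F₁) (≼-trans a≼h h≼F₂)
          (yes F₁≡F₂) →
            let _ , _ , _ , unique = factor-below-unique F₁-fact
                g≡h = trans (unique (∈-++⁺ˡ (∈-factors⁺ g-fact)) g≼F₁)
                            (sym (unique (∈-++⁺ʳ (factors G) (∈-factors⁺ h-fact))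
                                         (subst (h ≼_) (sym F₁≡F₂) h≼F₂)))
            in disjoint h h-fact (subst (Fact G) g≡h g-fact)

  -- 𝒢 need not be decidable, but it is ¬¬-decidable, which suffices for these conclusions.
  module _ {G H} (disjoint : ∀ F → Fact H F → Fact G F → ⊥)
           (nestedAntichain : IsNestedAntichain (Fact H ∪ Fact G)) where

    atoms-disjoint : ∀ {a} → Atoms G a → ¬ Atoms H a
    atoms-disjoint (atom , a≼G) (_ , a≼H) =
      ¬¬-decidable 𝒢 (λ 𝒢? → Decidable.Join.no-common-atom 𝒢? disjoint nestedAntichain atom a≼G a≼H)

    atoms-∨ : Atoms (G ∨ H) ≐ Atoms G ∪ Atoms H
    atoms-∨ = split , [ ≼∨ (x≼x∨y G H) , ≼∨ (y≼x∨y G H) ]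
      where
        ≼∨ : ∀ {Y} → Y ≼ (G ∨ H) → ∀ {a} → Atoms Y a → Atoms (G ∨ H) a
        ≼∨ Y≼X (atom , a≼Y) = atom , ≼-trans a≼Y Y≼X
        split : ∀ {a} → Atoms (G ∨ H) a → (Atoms G ∪ Atoms H) a
        split {a} (atom , a≼X) =
          Sum.map (atom ,_) (atom ,_) (decidable-stable ((a ≼? G) ⊎-dec (a ≼? H))
            (λ ¬split → ¬¬-decidable 𝒢 λ 𝒢? →
               ¬split (Decidable.Join.atom≼∨ 𝒢? disjoint nestedAntichain atom a≼X)))

mainTheorem10 : (D : DirectedBuiltLattice) → let open DirectedBuiltLattice D in
    ∀ G G₁ G₂ →
    Disjoint (Fact G₁) (Fact G) → Disjoint (Fact G₂) (Fact G) →
    IsNestedAntichain (Fact G₁ ∪ Fact G) → IsNestedAntichain (Fact G₂ ∪ Fact G) →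
    (G₁ ◁* G₂) ⇔ ((G ∨ G₁) ◁* (G ∨ G₂))
mainTheorem10 D G G₁ G₂ disjoint₁ disjoint₂ nested₁ nested₂ = begin
  G₁ ◁* G₂                                     ≈⟨ ◁*⇔◁ˢ G₁ G₂ ⟩
  Atoms G₁ ◁ˢ Atoms G₂                         ≈⟨ ◁ˢ⇔∪-disjoint (atoms-disjoint disjoint₁ nested₁)
                                                                 (atoms-disjoint disjoint₂ nested₂) ⟩
  (Atoms G ∪ Atoms G₁) ◁ˢ (Atoms G ∪ Atoms G₂) ≈⟨ ◁ˢ-cong (atoms-∨ disjoint₁ nested₁)
                                                          (atoms-∨ disjoint₂ nested₂) ⟨
  Atoms (G ∨ G₁) ◁ˢ Atoms (G ∨ G₂)             ≈⟨ ◁*⇔◁ˢ (G ∨ G₁) (G ∨ G₂) ⟨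
  (G ∨ G₁) ◁* (G ∨ G₂)                         ∎
  where
    open DirectedBuiltLattice D using (L; _∨_; isBuildingSet; _◁_; _◁*_)
    open FiniteLattice L using (Atoms)
    open Words D using (◁*⇔◁ˢ)
    open SetLex _◁_ using (_◁ˢ_; ◁ˢ-cong; ◁ˢ⇔∪-disjoint)
    open BuildingSet L isBuildingSet using (atoms-disjoint; atoms-∨)
    open import Relation.Unary using (_∪_)
    open import Relation.Binary.Reasoning.Setoid (⇔-setoid 0ℓ)
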